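{- $\mathsf{PostR}_{1/3}(MAJ_N) = \Theta(N)$, as $N\to\infty$.
   Context: $MAJ_N:\{0,1\}^N\rightarrow\{0,1\}$ is defined by $MAJ_N(x)=1$ if $|x|>N/2$ and $0$ if $|x|\le N/2$, where $|x|$ is the Hamming weight. $\mathsf{PostR}_\epsilon(f)$ is the minimum query complexity (maximum depth of a tree in the support) of a probability distribution $\mathcal{A}$ over deterministic decision trees with leaves labelled $0$, $1$ or $\perp$, chosen independently of the input, such that for every input $x$, $\Pr[\mathcal{A}(x)\neq\perp]>0$ and $\Pr[\mathcal{A}(x)=f(x)\mid\mathcal{A}(x)\neq\perp]\ge1-\epsilon$.
   Formalization: The probability distribution over deterministic decision trees has only rational weights. -}

module Defs where

open import Data.Nat using (ℕ; zero; suc; _+_; _*_; _<_; _≤_; _⊔_)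
open import Data.Fin using (Fin)
import Data.Fin as Fin
open import Data.Bool using (Bool; true; false; if_then_else_)
open import Data.Maybe using (Maybe; just; nothing)
open import Data.List using (List; []; _∷_)
open import Data.List.Relation.Unary.All using (All)
open import Data.Product using (_×_; _,_; ∃-syntax; proj₁; proj₂)
open import Relation.Binary.PropositionalEquality using (_≡_)
open import Relation.Nullary using (Dec; yes; no)
open import Data.Maybe.Properties using () renaming (≡-dec to maybe-≡-dec)
open import Data.Bool.Properties using () renaming (_≟_ to _≟B_)
open import Data.Rational using (ℚ; 0ℚ; 1ℚ; _-_)
  renaming (_+_ to _+ℚ_; _*_ to _*ℚ_; _≤_ to _≤ℚ_; _<_ to _<ℚ_)

Input : ℕ → Set
Input N = Fin N → Bool

weight : ∀ {N} → Input N → ℕ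
weight {zero}  x = 0
weight {suc N} x = (if x Fin.zero then 1 else 0) + weight (λ i → x (Fin.suc i))

MAJ : (N : ℕ) → Input N → Bool
MAJ N x with N <? (2 * weight x)
  where open import Data.Nat using (_<?_)
... | yes _ = true
... | no  _ = false

-- Leaf labels: just b for b ∈ {0,1}, nothing for ⊥.
Out : Set
Out = Maybe Bool

data DT (N : ℕ) : Set where
  leaf : Out → DT N
  node : Fin N → DT N → DT N → DT N

depth : ∀ {N} → DT N → ℕ
depth (leaf _)     = 0
depth (node _ l r) = suc (depth l ⊔ depth r)

eval : ∀ {N} → DT N → Input N → Out
eval (leaf o)     x = o
eval (node i l r) x = if x i then eval r x else eval l x

-- A randomized (post-selected) algorithm: a finitely supported probability
-- distribution over decision trees, given as a list of (weight, tree) pairs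
-- with strictly positive rational weights summing to 1 (so the list is the support).
Dist : ℕ → Set
Dist N = List (ℚ × DT N)

totalWeight : ∀ {N} → Dist N → ℚ
totalWeight []             = 0ℚ
totalWeight ((p , _) ∷ ds) = p +ℚ totalWeight ds

IsDistribution : ∀ {N} → Dist N → Set
IsDistribution A = All (λ pt → 0ℚ <ℚ proj₁ pt) A × totalWeight A ≡ 1ℚ

distDepth : ∀ {N} → Dist N → ℕ
distDepth []             = 0
distDepth ((_ , t) ∷ ds) = depth t ⊔ distDepth ds

prob : ∀ {N} → (Out → Bool) → Dist N → Input N → ℚ
prob S []             x = 0ℚ
prob S ((p , t) ∷ ds) x = (if S (eval t x) then p else 0ℚ) +ℚ prob S ds x

isNotBot : Out → Bool
isNotBot (just _) = true
isNotBot nothing  = false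

isOut : Bool → Out → Bool
isOut b (just c) with b ≟B c
... | yes _ = true
... | no  _ = false
isOut b nothing = false

-- A is a valid PostR_ε algorithm for f: for every x,
-- Pr[A(x) ≠ ⊥] > 0 and Pr[A(x) = f(x) | A(x) ≠ ⊥] ≥ 1 - ε,
-- the latter written as Pr[A(x) = f(x)] ≥ (1 - ε) · Pr[A(x) ≠ ⊥].
PostAlg : ∀ {N} → ℚ → (Input N → Bool) → Dist N → Set
PostAlg ε f A =
  IsDistribution A ×
  (∀ x → (0ℚ <ℚ prob isNotBot A x) ×
         (((1ℚ - ε) *ℚ prob isNotBot A x) ≤ℚ prob (isOut (f x)) A x))

PostR≤ : ∀ {N} → ℚ → (Input N → Bool) → ℕ → Set
PostR≤ ε f d = ∃[ A ] (PostAlg ε f A × distDepth A ≤ d)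

module Submission where

-- The upper bound reads all N bits. For the lower bound let w = ⌊N/2⌋, so MAJ is 0 on the
-- Hamming layer w and 1 on layer w + 1. Inside a subcube, double counting the edges between
-- the two layers shows that every point of layer w has up-degree N - w and every point of
-- layer w + 1 has down-degree w + 1 (minus the coordinates the subcube fixes). Each query of a
-- decision tree fixes one coordinate and lowers one of these degrees by one, so the inputs of
-- either layer reaching an S-labelled leaf of a depth-d tree satisfy
--   (w + 1 - d) · #S(w + 1) ≤ (N - w) · #S(w)   and   (N - w - d) · #S(w) ≤ (w + 1) · #S(w + 1).
-- Averaging over the trees of an algorithm gives the same inequalities for the masses T_v, F_v
-- of the outputs 1, 0 on layer v. Post-selection with error 1/3 gives 2 T_w ≤ F_w, F_w > 0 and
-- 2 F_{w+1} ≤ T_{w+1}; chaining the four inequalities yields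
-- 4 (w + 1 - d) (N - w - d) ≤ (w + 1) (N - w), which fails as soon as 4 d < N.

open import Defs
open import Algebra.Bundles using (CommutativeMonoid; Semiring; Ring)
open import Data.Bool using (Bool; true; false; not; if_then_else_)
open import Data.Empty using (⊥-elim)
open import Data.Fin using (Fin; zero; suc)
open import Data.List using ([]; _∷_)
open import Data.List.Relation.Unary.All using (All; []; _∷_)
open import Data.Maybe using (Maybe; just; nothing)
open import Data.Nat using (ℕ; zero; suc; _+_; _*_; _∸_; _≤_; _<_; z≤n; s≤s; _<?_; ⌊_/2⌋)
open import Data.Nat.Properties as ℕ using ()
open import Data.Product using (_×_; _,_; proj₁; proj₂; ∃-syntax)
open import Data.Rational using (ℚ; 0ℚ; 1ℚ; -_; _-_; _/_)
  renaming (_+_ to _+ℚ_; _*_ to _*ℚ_; _≤_ to _≤ℚ_; _<_ to _<ℚ_)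
import Data.Rational.Properties as ℚ
open import Data.Unit using (⊤; tt)
open import Data.Vec using (Vec; []; _∷_; lookup; replicate; _[_]≔_)
open import Data.Vec.Properties using (lookup∘update)
open import Data.Vec.Functional using (tail) renaming ([] to ⟨⟩; _∷_ to _◃_)
open import Function using (_∘_; id)
open import Relation.Binary.PropositionalEquality
  using (_≡_; refl; cong; cong₂; sym; trans; subst; subst₂; module ≡-Reasoning)
open import Relation.Nullary using (yes; no)

variable
  N : ℕ

-- Subcubes and sums over their layers

Subcube : ℕ → Set
Subcube = Vec (Maybe Bool)

unrestricted : ∀ N → Subcube N
unrestricted N = replicate N nothing

_∈ᶜ_ : Input N → Subcube N → Set
x ∈ᶜ []            = ⊤
x ∈ᶜ (nothing ∷ ρ) = tail x ∈ᶜ ρ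
x ∈ᶜ (just b ∷ ρ)  = x zero ≡ b × tail x ∈ᶜ ρ

∈ᶜ-lookup : ∀ (ρ : Subcube N) {x} i {b} → x ∈ᶜ ρ → lookup ρ i ≡ just b → x i ≡ b
∈ᶜ-lookup (just _ ∷ _)  zero    (x₀≡b , _) refl = x₀≡b
∈ᶜ-lookup (nothing ∷ ρ) (suc i) x∈ρ        eq   = ∈ᶜ-lookup ρ i x∈ρ eq
∈ᶜ-lookup (just _ ∷ ρ)  (suc i) (_ , x∈ρ)  eq   = ∈ᶜ-lookup ρ i x∈ρ eq

fixed : Bool → Subcube N → ℕ
fixed b     []               = 0
fixed b     (nothing ∷ ρ)    = fixed b ρ
fixed false (just false ∷ ρ) = suc (fixed false ρ)
fixed true  (just true ∷ ρ)  = suc (fixed true ρ)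
fixed b     (just _ ∷ ρ)     = fixed b ρ

fixed-unrestricted : ∀ b N → fixed b (unrestricted N) ≡ 0
fixed-unrestricted b zero    = refl
fixed-unrestricted b (suc N) = fixed-unrestricted b N

fixed-fix : ∀ (ρ : Subcube N) i b → lookup ρ i ≡ nothing →
            fixed b (ρ [ i ]≔ just b) ≡ suc (fixed b ρ)
fixed-fix (nothing ∷ ρ)    zero    false refl = refl
fixed-fix (nothing ∷ ρ)    zero    true  refl = refl
fixed-fix (nothing ∷ ρ)    (suc i) b     eq   = fixed-fix ρ i b eq
fixed-fix (just false ∷ ρ) (suc i) false eq   = cong suc (fixed-fix ρ i false eq)
fixed-fix (just false ∷ ρ) (suc i) true  eq   = fixed-fix ρ i true eq
fixed-fix (just true ∷ ρ)  (suc i) false eq   = fixed-fix ρ i false eq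
fixed-fix (just true ∷ ρ)  (suc i) true  eq   = cong suc (fixed-fix ρ i true eq)

fixed-fix-not : ∀ (ρ : Subcube N) i b → lookup ρ i ≡ nothing →
                fixed (not b) (ρ [ i ]≔ just b) ≡ fixed (not b) ρ
fixed-fix-not (nothing ∷ ρ)    zero    false refl = refl
fixed-fix-not (nothing ∷ ρ)    zero    true  refl = refl
fixed-fix-not (nothing ∷ ρ)    (suc i) b     eq   = fixed-fix-not ρ i b eq
fixed-fix-not (just false ∷ ρ) (suc i) false eq   = fixed-fix-not ρ i false eq
fixed-fix-not (just false ∷ ρ) (suc i) true  eq   = cong suc (fixed-fix-not ρ i true eq)
fixed-fix-not (just true ∷ ρ)  (suc i) false eq   = cong suc (fixed-fix-not ρ i false eq)
fixed-fix-not (just true ∷ ρ)  (suc i) true  eq   = fixed-fix-not ρ i true eq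

module _ {c} {A : Set c} (ε : A) (_∙_ : A → A → A) where

  layerSum : Subcube N → ℕ → (Input N → A) → A
  layerSum []               zero    g = g ⟨⟩
  layerSum []               (suc w) g = ε
  layerSum (nothing ∷ ρ)    zero    g = layerSum ρ zero (λ x → g (false ◃ x))
  layerSum (nothing ∷ ρ)    (suc w) g =
    layerSum ρ (suc w) (λ x → g (false ◃ x)) ∙ layerSum ρ w (λ x → g (true ◃ x))
  layerSum (just false ∷ ρ) w       g = layerSum ρ w (λ x → g (false ◃ x))
  layerSum (just true ∷ ρ)  zero    g = ε
  layerSum (just true ∷ ρ)  (suc w) g = layerSum ρ w (λ x → g (true ◃ x))

  module _ {ℓ} (_∼_ : A → A → Set ℓ) (ε∼ε : ε ∼ ε)
           (∙-mono : ∀ {a b c d} → a ∼ b → c ∼ d → (a ∙ c) ∼ (b ∙ d)) where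

    layerSum-preserves : ∀ (ρ : Subcube N) w {f g} →
                         (∀ x → x ∈ᶜ ρ → weight x ≡ w → f x ∼ g x) → layerSum ρ w f ∼ layerSum ρ w g
    layerSum-preserves []               zero    f∼g = f∼g ⟨⟩ tt refl
    layerSum-preserves []               (suc w) f∼g = ε∼ε
    layerSum-preserves (nothing ∷ ρ)    zero    f∼g =
      layerSum-preserves ρ zero λ x x∈ρ → f∼g (false ◃ x) x∈ρ
    layerSum-preserves (nothing ∷ ρ)    (suc w) f∼g =
      ∙-mono (layerSum-preserves ρ (suc w) λ x x∈ρ → f∼g (false ◃ x) x∈ρ)
             (layerSum-preserves ρ w λ x x∈ρ |x|≡w → f∼g (true ◃ x) x∈ρ (cong suc |x|≡w))
    layerSum-preserves (just false ∷ ρ) w       f∼g =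
      layerSum-preserves ρ w λ x x∈ρ → f∼g (false ◃ x) (refl , x∈ρ)
    layerSum-preserves (just true ∷ ρ)  zero    f∼g = ε∼ε
    layerSum-preserves (just true ∷ ρ)  (suc w) f∼g =
      layerSum-preserves ρ w λ x x∈ρ |x|≡w → f∼g (true ◃ x) (refl , x∈ρ) (cong suc |x|≡w)

module LayerSum {c ℓ} (M : CommutativeMonoid c ℓ) where

  open CommutativeMonoid M renaming (refl to ≈-refl; sym to ≈-sym; trans to ≈-trans)
  open import Algebra.Properties.CommutativeSemigroup commutativeSemigroup using (interchange)
  open import Algebra.Properties.CommutativeMonoid.Mult M using (×-homo-+) renaming (_×_ to _·_)

  Σ : Subcube N → ℕ → (Input N → Carrier) → Carrier
  Σ = layerSum ε _∙_

  Σ-cong : ∀ (ρ : Subcube N) w {f g} → (∀ x → x ∈ᶜ ρ → weight x ≡ w → f x ≈ g x) → Σ ρ w f ≈ Σ ρ w g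
  Σ-cong = layerSum-preserves ε _∙_ _≈_ ≈-refl ∙-cong

  Σ-homo : ∀ {a} {A : Set a} {ε₀ : A} {_∙₀_ : A → A → A} (h : A → Carrier) →
           h ε₀ ≈ ε → (∀ x y → h (x ∙₀ y) ≈ h x ∙ h y) →
           ∀ (ρ : Subcube N) w f → h (layerSum ε₀ _∙₀_ ρ w f) ≈ Σ ρ w (h ∘ f)
  Σ-homo h h-ε h-∙ []               zero    f = ≈-refl
  Σ-homo h h-ε h-∙ []               (suc w) f = h-ε
  Σ-homo h h-ε h-∙ (nothing ∷ ρ)    zero    f = Σ-homo h h-ε h-∙ ρ zero _
  Σ-homo h h-ε h-∙ (nothing ∷ ρ)    (suc w) f =
    ≈-trans (h-∙ _ _) (∙-cong (Σ-homo h h-ε h-∙ ρ (suc w) _) (Σ-homo h h-ε h-∙ ρ w _))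
  Σ-homo h h-ε h-∙ (just false ∷ ρ) w       f = Σ-homo h h-ε h-∙ ρ w _
  Σ-homo h h-ε h-∙ (just true ∷ ρ)  zero    f = h-ε
  Σ-homo h h-ε h-∙ (just true ∷ ρ)  (suc w) f = Σ-homo h h-ε h-∙ ρ w _

  Σ-ε : ∀ (ρ : Subcube N) w → Σ ρ w (λ _ → ε) ≈ ε
  Σ-ε ρ w = ≈-sym (Σ-homo {ε₀ = ε} {_∙_} (λ _ → ε) ≈-refl (λ _ _ → ≈-sym (identityˡ ε)) ρ w (λ _ → ε))

  Σ-∙ : ∀ (ρ : Subcube N) w f g → Σ ρ w (λ x → f x ∙ g x) ≈ Σ ρ w f ∙ Σ ρ w g
  Σ-∙ []               zero    f g = ≈-refl
  Σ-∙ []               (suc w) f g = ≈-sym (identityˡ ε)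
  Σ-∙ (nothing ∷ ρ)    zero    f g = Σ-∙ ρ zero _ _
  Σ-∙ (nothing ∷ ρ)    (suc w) f g =
    ≈-trans (∙-cong (Σ-∙ ρ (suc w) _ _) (Σ-∙ ρ w _ _)) (interchange _ _ _ _)
  Σ-∙ (just false ∷ ρ) w       f g = Σ-∙ ρ w _ _
  Σ-∙ (just true ∷ ρ)  zero    f g = ≈-sym (identityˡ ε)
  Σ-∙ (just true ∷ ρ)  (suc w) f g = Σ-∙ ρ w _ _

  Σ-fix : ∀ (ρ : Subcube N) i → lookup ρ i ≡ nothing → ∀ w g →
          Σ ρ w g ≈ Σ (ρ [ i ]≔ just false) w g ∙ Σ (ρ [ i ]≔ just true) w g
  Σ-fix (nothing ∷ ρ)    zero    refl zero    g = ≈-sym (identityʳ _)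
  Σ-fix (nothing ∷ ρ)    zero    refl (suc w) g = ≈-refl
  Σ-fix (nothing ∷ ρ)    (suc i) eq   zero    g = Σ-fix ρ i eq zero _
  Σ-fix (nothing ∷ ρ)    (suc i) eq   (suc w) g =
    ≈-trans (∙-cong (Σ-fix ρ i eq (suc w) _) (Σ-fix ρ i eq w _)) (interchange _ _ _ _)
  Σ-fix (just false ∷ ρ) (suc i) eq   w       g = Σ-fix ρ i eq w _
  Σ-fix (just true ∷ ρ)  (suc i) eq   zero    g = ≈-sym (identityˡ ε)
  Σ-fix (just true ∷ ρ)  (suc i) eq   (suc w) g = Σ-fix ρ i eq w _

  Σ-· : ∀ (ρ : Subcube N) w (f : Input N → ℕ) a → Σ ρ w (λ x → f x · a) ≈ layerSum 0 _+_ ρ w f · a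
  Σ-· ρ w f a = ≈-sym (Σ-homo (_· a) ≈-refl (λ m n → ×-homo-+ a m n) ρ w f)

module ScaledLayerSum {c ℓ} (R : Semiring c ℓ) where

  open Semiring R using (_≈_; zeroʳ; distribˡ; +-commutativeMonoid) renaming (_*_ to _⊛_; sym to ≈-sym)
  open LayerSum +-commutativeMonoid public

  Σ-*ˡ : ∀ (ρ : Subcube N) w a f → Σ ρ w (λ x → a ⊛ f x) ≈ a ⊛ Σ ρ w f
  Σ-*ˡ ρ w a f = ≈-sym (Σ-homo (a ⊛_) (zeroʳ a) (distribˡ a) ρ w f)

module Σℕ = ScaledLayerSum ℕ.+-*-semiring

-- Edges between adjacent layers

freeZeros : Subcube N → Input N → ℕ
freeZeros []            x = 0
freeZeros (nothing ∷ ρ) x = (if x zero then 0 else 1) + freeZeros ρ (tail x)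
freeZeros (just _ ∷ ρ)  x = freeZeros ρ (tail x)

freeOnes : Subcube N → Input N → ℕ
freeOnes []            x = 0
freeOnes (nothing ∷ ρ) x = (if x zero then 1 else 0) + freeOnes ρ (tail x)
freeOnes (just _ ∷ ρ)  x = freeOnes ρ (tail x)

freeZeros-weight : ∀ (ρ : Subcube N) x → x ∈ᶜ ρ → freeZeros ρ x + fixed false ρ + weight x ≡ N
freeZeros-weight []            x _ = refl
freeZeros-weight (nothing ∷ ρ) x x∈ρ with x zero
... | false = cong suc (freeZeros-weight ρ (tail x) x∈ρ)
... | true  = trans (ℕ.+-suc _ _) (cong suc (freeZeros-weight ρ (tail x) x∈ρ))
freeZeros-weight (just false ∷ ρ) x (x₀≡0 , x∈ρ) rewrite x₀≡0 =
  trans (cong (_+ weight (tail x)) (ℕ.+-suc (freeZeros ρ (tail x)) _))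
        (cong suc (freeZeros-weight ρ (tail x) x∈ρ))
freeZeros-weight (just true ∷ ρ)  x (x₀≡1 , x∈ρ) rewrite x₀≡1 =
  trans (ℕ.+-suc _ _) (cong suc (freeZeros-weight ρ (tail x) x∈ρ))

freeOnes-weight : ∀ (ρ : Subcube N) x → x ∈ᶜ ρ → freeOnes ρ x + fixed true ρ ≡ weight x
freeOnes-weight []            x _ = refl
freeOnes-weight (nothing ∷ ρ) x x∈ρ with x zero
... | false = freeOnes-weight ρ (tail x) x∈ρ
... | true  = cong suc (freeOnes-weight ρ (tail x) x∈ρ)
freeOnes-weight (just false ∷ ρ) x (x₀≡0 , x∈ρ) rewrite x₀≡0 = freeOnes-weight ρ (tail x) x∈ρ
freeOnes-weight (just true ∷ ρ)  x (x₀≡1 , x∈ρ) rewrite x₀≡1 =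
  trans (ℕ.+-suc _ _) (cong suc (freeOnes-weight ρ (tail x) x∈ρ))

-- The number of neighbours in ρ of a point of layer w one layer up, and of a point of layer
-- w + 1 one layer down.
upDegree : Subcube N → ℕ → ℕ
upDegree {N} ρ w = N ∸ w ∸ fixed false ρ

downDegree : Subcube N → ℕ → ℕ
downDegree ρ w = suc w ∸ fixed true ρ

freeZeros-on-layer : ∀ (ρ : Subcube N) {w} x → x ∈ᶜ ρ → weight x ≡ w → freeZeros ρ x ≡ upDegree ρ w
freeZeros-on-layer {N} ρ {w} x x∈ρ refl = begin
  freeZeros ρ x                                          ≡⟨ ℕ.m+n∸n≡m _ (fixed false ρ) ⟨
  freeZeros ρ x + fixed false ρ ∸ fixed false ρ          ≡⟨ cong (_∸ fixed false ρ) (ℕ.m+n∸n≡m _ w) ⟨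
  freeZeros ρ x + fixed false ρ + w ∸ w ∸ fixed false ρ
    ≡⟨ cong (λ n → n ∸ w ∸ fixed false ρ) (freeZeros-weight ρ x x∈ρ) ⟩
  N ∸ w ∸ fixed false ρ                                  ∎
  where open ≡-Reasoning

freeOnes-on-layer : ∀ (ρ : Subcube N) {w} x → x ∈ᶜ ρ → weight x ≡ suc w → freeOnes ρ x ≡ downDegree ρ w
freeOnes-on-layer ρ x x∈ρ |x|≡1+w = begin
  freeOnes ρ x                                ≡⟨ ℕ.m+n∸n≡m _ (fixed true ρ) ⟨
  freeOnes ρ x + fixed true ρ ∸ fixed true ρ  ≡⟨ cong (_∸ fixed true ρ) (trans (freeOnes-weight ρ x x∈ρ) |x|≡1+w) ⟩
  downDegree ρ _                              ∎
  where open ≡-Reasoning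

freeOnes-bottom : ∀ (ρ : Subcube N) x → x ∈ᶜ ρ → weight x ≡ 0 → freeOnes ρ x ≡ 0
freeOnes-bottom ρ x x∈ρ |x|≡0 = ℕ.m+n≡0⇒m≡0 _ (trans (freeOnes-weight ρ x x∈ρ) |x|≡0)

layerSize : Subcube N → ℕ → ℕ
layerSize ρ w = Σℕ.Σ ρ w (λ _ → 1)

edge-double-count : ∀ (ρ : Subcube N) w → Σℕ.Σ ρ w (freeZeros ρ) ≡ Σℕ.Σ ρ (suc w) (freeOnes ρ)
edge-double-count []               zero    = refl
edge-double-count []               (suc w) = refl
edge-double-count (nothing ∷ ρ)    zero    = begin
  Σ ρ 0 (λ x → 1 + freeZeros ρ x)                     ≡⟨ Σ-+ ρ 0 (λ _ → 1) (freeZeros ρ) ⟩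
  layerSize ρ 0 + Σ ρ 0 (freeZeros ρ)                 ≡⟨ cong₂ _+_ size≡ (edge-double-count ρ 0) ⟩
  Σ ρ 0 (λ x → 1 + freeOnes ρ x) + Σ ρ 1 (freeOnes ρ) ≡⟨ ℕ.+-comm (Σ ρ 0 (λ x → 1 + freeOnes ρ x)) _ ⟩
  Σ ρ 1 (freeOnes ρ) + Σ ρ 0 (λ x → 1 + freeOnes ρ x) ∎
  where open ≡-Reasoning
        open Σℕ renaming (Σ-∙ to Σ-+)
        size≡ = Σ-cong ρ 0 λ x x∈ρ |x|≡0 → cong suc (sym (freeOnes-bottom ρ x x∈ρ |x|≡0))
edge-double-count (nothing ∷ ρ)    (suc w) = begin
  Σ ρ (suc w) (λ x → 1 + freeZeros ρ x) + Σ ρ w (freeZeros ρ)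
    ≡⟨ cong₂ _+_ (Σ-+ ρ (suc w) (λ _ → 1) (freeZeros ρ)) (edge-double-count ρ w) ⟩
  layerSize ρ (suc w) + Σ ρ (suc w) (freeZeros ρ) + Σ ρ (suc w) (freeOnes ρ)
    ≡⟨ cong (λ s → layerSize ρ (suc w) + s + Σ ρ (suc w) (freeOnes ρ)) (edge-double-count ρ (suc w)) ⟩
  layerSize ρ (suc w) + Σ ρ (suc (suc w)) (freeOnes ρ) + Σ ρ (suc w) (freeOnes ρ)
    ≡⟨ xy∙z≈y∙xz (layerSize ρ (suc w)) _ _ ⟩
  Σ ρ (suc (suc w)) (freeOnes ρ) + (layerSize ρ (suc w) + Σ ρ (suc w) (freeOnes ρ))
    ≡⟨ cong (Σ ρ (suc (suc w)) (freeOnes ρ) +_) (Σ-+ ρ (suc w) (λ _ → 1) (freeOnes ρ)) ⟨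
  Σ ρ (suc (suc w)) (freeOnes ρ) + Σ ρ (suc w) (λ x → 1 + freeOnes ρ x)
    ∎
  where open ≡-Reasoning
        open Σℕ renaming (Σ-∙ to Σ-+)
        open import Algebra.Properties.CommutativeSemigroup ℕ.+-commutativeSemigroup using (xy∙z≈y∙xz)
edge-double-count (just false ∷ ρ) w       = edge-double-count ρ w
edge-double-count (just true ∷ ρ)  zero    =
  sym (trans (Σℕ.Σ-cong ρ 0 (freeOnes-bottom ρ)) (Σℕ.Σ-ε ρ 0))
edge-double-count (just true ∷ ρ)  (suc w) = edge-double-count ρ w

layer-edge-count : ∀ (ρ : Subcube N) w →
                   upDegree ρ w * layerSize ρ w ≡ downDegree ρ w * layerSize ρ (suc w)
layer-edge-count ρ w = begin
  upDegree ρ w * layerSize ρ w              ≡⟨ Σ-*ˡ ρ w (upDegree ρ w) (λ _ → 1) ⟨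
  Σ ρ w (λ _ → upDegree ρ w * 1)
    ≡⟨ Σ-cong ρ w (λ x x∈ρ |x|≡w → trans (ℕ.*-identityʳ _) (sym (freeZeros-on-layer ρ x x∈ρ |x|≡w))) ⟩
  Σ ρ w (freeZeros ρ)                       ≡⟨ edge-double-count ρ w ⟩
  Σ ρ (suc w) (freeOnes ρ)
    ≡⟨ Σ-cong ρ (suc w) (λ x x∈ρ |x|≡1+w → trans (freeOnes-on-layer ρ x x∈ρ |x|≡1+w) (sym (ℕ.*-identityʳ _))) ⟩
  Σ ρ (suc w) (λ _ → downDegree ρ w * 1)    ≡⟨ Σ-*ˡ ρ (suc w) (downDegree ρ w) (λ _ → 1) ⟩
  downDegree ρ w * layerSize ρ (suc w)      ∎
  where open ≡-Reasoning
        open Σℕ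

m∸[1+n]≡m∸n∸1 : ∀ m n → m ∸ suc n ≡ m ∸ n ∸ 1
m∸[1+n]≡m∸n∸1 m n = trans (cong (m ∸_) (ℕ.+-comm 1 n)) (sym (ℕ.∸-+-assoc m n 1))

module _ {N} (ρ : Subcube N) (i : Fin N) (w : ℕ) (free : lookup ρ i ≡ nothing) where

  upDegree-fix-false : upDegree (ρ [ i ]≔ just false) w ≡ upDegree ρ w ∸ 1
  upDegree-fix-false =
    trans (cong (_ ∸ w ∸_) (fixed-fix ρ i false free)) (m∸[1+n]≡m∸n∸1 (N ∸ w) (fixed false ρ))

  upDegree-fix-true : upDegree (ρ [ i ]≔ just true) w ≡ upDegree ρ w
  upDegree-fix-true = cong (_ ∸ w ∸_) (fixed-fix-not ρ i true free)

  downDegree-fix-true : downDegree (ρ [ i ]≔ just true) w ≡ downDegree ρ w ∸ 1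
  downDegree-fix-true =
    trans (cong (suc w ∸_) (fixed-fix ρ i true free)) (m∸[1+n]≡m∸n∸1 (suc w) (fixed true ρ))

  downDegree-fix-false : downDegree (ρ [ i ]≔ just false) w ≡ downDegree ρ w
  downDegree-fix-false = cong (suc w ∸_) (fixed-fix-not ρ i false free)

-- Decision trees on two adjacent layers

layerCount : DT N → (Out → Bool) → Subcube N → ℕ → ℕ
layerCount t S ρ w = Σℕ.Σ ρ w (λ x → if S (eval t x) then 1 else 0)

module _ (S : Out → Bool) {i : Fin N} (l r : DT N) (w : ℕ) where

  layerCount-node-0 : ∀ (ρ : Subcube N) → lookup ρ i ≡ just false →
                      layerCount (node i l r) S ρ w ≡ layerCount l S ρ w
  layerCount-node-0 ρ xᵢ≡0 = Σℕ.Σ-cong ρ w λ x x∈ρ _ →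
    cong (λ b → if S (if b then eval r x else eval l x) then 1 else 0) (∈ᶜ-lookup ρ i x∈ρ xᵢ≡0)

  layerCount-node-1 : ∀ (ρ : Subcube N) → lookup ρ i ≡ just true →
                      layerCount (node i l r) S ρ w ≡ layerCount r S ρ w
  layerCount-node-1 ρ xᵢ≡1 = Σℕ.Σ-cong ρ w λ x x∈ρ _ →
    cong (λ b → if S (if b then eval r x else eval l x) then 1 else 0) (∈ᶜ-lookup ρ i x∈ρ xᵢ≡1)

  layerCount-node-free : ∀ (ρ : Subcube N) → lookup ρ i ≡ nothing →
    layerCount (node i l r) S ρ w ≡ layerCount l S (ρ [ i ]≔ just false) w + layerCount r S (ρ [ i ]≔ just true) w
  layerCount-node-free ρ free =
    trans (Σℕ.Σ-fix ρ i free w (λ x → if S (eval (node i l r) x) then 1 else 0))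
          (cong₂ _+_ (layerCount-node-0 (ρ [ i ]≔ just false) (lookup∘update i ρ (just false)))
                     (layerCount-node-1 (ρ [ i ]≔ just true) (lookup∘update i ρ (just true))))

*-+-mono-≤ : ∀ a b {x₀ x₁ y₀ y₁} → a * x₀ ≤ b * y₀ → a * x₁ ≤ b * y₁ → a * (x₀ + x₁) ≤ b * (y₀ + y₁)
*-+-mono-≤ a b {x₀} {x₁} {y₀} {y₁} ax₀≤by₀ ax₁≤by₁ =
  subst₂ _≤_ (sym (ℕ.*-distribˡ-+ a x₀ x₁)) (sym (ℕ.*-distribˡ-+ b y₀ y₁)) (ℕ.+-mono-≤ ax₀≤by₀ ax₁≤by₁)

*-≤-weaken : ∀ {a a′ b b′ x y} → a′ ≤ a → b ≤ b′ → a * x ≤ b * y → a′ * x ≤ b′ * y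
*-≤-weaken {x = x} {y} a′≤a b≤b′ ax≤by =
  ℕ.≤-trans (ℕ.*-monoˡ-≤ x a′≤a) (ℕ.≤-trans ax≤by (ℕ.*-monoˡ-≤ y b≤b′))

m∸[1+n]≤m∸n : ∀ m n → m ∸ suc n ≤ m ∸ n
m∸[1+n]≤m∸n m n = ℕ.∸-monoʳ-≤ m (ℕ.n≤1+n n)

-- Answering a query on a free coordinate lowers upDegree (answer 0) or downDegree (answer 1)
-- by one: one unit of the query budget pays for this when that degree carries the budget,
-- and monotonicity absorbs it otherwise.
module _ (S : Out → Bool) where

  layerCount-ascent : ∀ (T : DT N) {d} → depth T ≤ d → ∀ ρ w →
    (downDegree ρ w ∸ d) * layerCount T S ρ (suc w) ≤ upDegree ρ w * layerCount T S ρ w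
  layerCount-ascent (leaf o) {d} _ ρ w with S o
  ... | true  = ℕ.≤-trans (ℕ.*-monoˡ-≤ (layerSize ρ (suc w)) (ℕ.m∸n≤m _ d))
                          (ℕ.≤-reflexive (sym (layer-edge-count ρ w)))
  ... | false rewrite Σℕ.Σ-ε ρ (suc w) | ℕ.*-zeroʳ (downDegree ρ w ∸ d) = z≤n
  layerCount-ascent (node i l r) {suc d} (s≤s depth≤d) ρ w with lookup ρ i in xᵢ
  ... | just false = subst₂ (λ a b → (downDegree ρ w ∸ suc d) * a ≤ upDegree ρ w * b)
          (sym (layerCount-node-0 S l r (suc w) ρ xᵢ)) (sym (layerCount-node-0 S l r w ρ xᵢ))
          (layerCount-ascent l (ℕ.m≤n⇒m≤1+n (ℕ.m⊔n≤o⇒m≤o _ _ depth≤d)) ρ w)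
  ... | just true  = subst₂ (λ a b → (downDegree ρ w ∸ suc d) * a ≤ upDegree ρ w * b)
          (sym (layerCount-node-1 S l r (suc w) ρ xᵢ)) (sym (layerCount-node-1 S l r w ρ xᵢ))
          (layerCount-ascent r (ℕ.m≤n⇒m≤1+n (ℕ.m⊔n≤o⇒n≤o _ _ depth≤d)) ρ w)
  ... | nothing    = subst₂ (λ a b → (downDegree ρ w ∸ suc d) * a ≤ upDegree ρ w * b)
          (sym (layerCount-node-free S l r (suc w) ρ xᵢ)) (sym (layerCount-node-free S l r w ρ xᵢ))
          (*-+-mono-≤ (downDegree ρ w ∸ suc d) (upDegree ρ w) ascent₀ ascent₁)
    where
      ρ₀ = ρ [ i ]≔ just false
      ρ₁ = ρ [ i ]≔ just true
      ascent₀ : (downDegree ρ w ∸ suc d) * layerCount l S ρ₀ (suc w) ≤ upDegree ρ w * layerCount l S ρ₀ w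
      ascent₀ = *-≤-weaken (m∸[1+n]≤m∸n (downDegree ρ w) d) (ℕ.m∸n≤m (upDegree ρ w) 1)
        (subst₂ (λ a b → (a ∸ d) * layerCount l S ρ₀ (suc w) ≤ b * layerCount l S ρ₀ w)
          (downDegree-fix-false ρ i w xᵢ) (upDegree-fix-false ρ i w xᵢ)
          (layerCount-ascent l (ℕ.m⊔n≤o⇒m≤o _ _ depth≤d) ρ₀ w))
      ascent₁ : (downDegree ρ w ∸ suc d) * layerCount r S ρ₁ (suc w) ≤ upDegree ρ w * layerCount r S ρ₁ w
      ascent₁ = subst₂ (λ a b → a * layerCount r S ρ₁ (suc w) ≤ b * layerCount r S ρ₁ w)
        (trans (cong (_∸ d) (downDegree-fix-true ρ i w xᵢ)) (ℕ.∸-+-assoc (downDegree ρ w) 1 d))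
        (upDegree-fix-true ρ i w xᵢ)
        (layerCount-ascent r (ℕ.m⊔n≤o⇒n≤o _ _ depth≤d) ρ₁ w)

  layerCount-descent : ∀ (T : DT N) {d} → depth T ≤ d → ∀ ρ w →
    (upDegree ρ w ∸ d) * layerCount T S ρ w ≤ downDegree ρ w * layerCount T S ρ (suc w)
  layerCount-descent (leaf o) {d} _ ρ w with S o
  ... | true  = ℕ.≤-trans (ℕ.*-monoˡ-≤ (layerSize ρ w) (ℕ.m∸n≤m _ d)) (ℕ.≤-reflexive (layer-edge-count ρ w))
  ... | false rewrite Σℕ.Σ-ε ρ w | ℕ.*-zeroʳ (upDegree ρ w ∸ d) = z≤n
  layerCount-descent (node i l r) {suc d} (s≤s depth≤d) ρ w with lookup ρ i in xᵢ
  ... | just false = subst₂ (λ a b → (upDegree ρ w ∸ suc d) * a ≤ downDegree ρ w * b)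
          (sym (layerCount-node-0 S l r w ρ xᵢ)) (sym (layerCount-node-0 S l r (suc w) ρ xᵢ))
          (layerCount-descent l (ℕ.m≤n⇒m≤1+n (ℕ.m⊔n≤o⇒m≤o _ _ depth≤d)) ρ w)
  ... | just true  = subst₂ (λ a b → (upDegree ρ w ∸ suc d) * a ≤ downDegree ρ w * b)
          (sym (layerCount-node-1 S l r w ρ xᵢ)) (sym (layerCount-node-1 S l r (suc w) ρ xᵢ))
          (layerCount-descent r (ℕ.m≤n⇒m≤1+n (ℕ.m⊔n≤o⇒n≤o _ _ depth≤d)) ρ w)
  ... | nothing    = subst₂ (λ a b → (upDegree ρ w ∸ suc d) * a ≤ downDegree ρ w * b)
          (sym (layerCount-node-free S l r w ρ xᵢ)) (sym (layerCount-node-free S l r (suc w) ρ xᵢ))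
          (*-+-mono-≤ (upDegree ρ w ∸ suc d) (downDegree ρ w) descent₀ descent₁)
    where
      ρ₀ = ρ [ i ]≔ just false
      ρ₁ = ρ [ i ]≔ just true
      descent₀ : (upDegree ρ w ∸ suc d) * layerCount l S ρ₀ w ≤ downDegree ρ w * layerCount l S ρ₀ (suc w)
      descent₀ = subst₂ (λ a b → a * layerCount l S ρ₀ w ≤ b * layerCount l S ρ₀ (suc w))
        (trans (cong (_∸ d) (upDegree-fix-false ρ i w xᵢ)) (ℕ.∸-+-assoc (upDegree ρ w) 1 d))
        (downDegree-fix-false ρ i w xᵢ)
        (layerCount-descent l (ℕ.m⊔n≤o⇒m≤o _ _ depth≤d) ρ₀ w)
      descent₁ : (upDegree ρ w ∸ suc d) * layerCount r S ρ₁ w ≤ downDegree ρ w * layerCount r S ρ₁ (suc w)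
      descent₁ = *-≤-weaken (m∸[1+n]≤m∸n (upDegree ρ w) d) (ℕ.m∸n≤m (downDegree ρ w) 1)
        (subst₂ (λ a b → (a ∸ d) * layerCount r S ρ₁ w ≤ b * layerCount r S ρ₁ (suc w))
          (upDegree-fix-true ρ i w xᵢ) (downDegree-fix-true ρ i w xᵢ)
          (layerCount-descent r (ℕ.m⊔n≤o⇒n≤o _ _ depth≤d) ρ₁ w))

-- Randomised algorithms

open import Algebra.Properties.CommutativeMonoid.Mult ℚ.+-0-commutativeMonoid
  using (×-assocˡ; ×-distrib-+) renaming (_×_ to _·_)

·-zeroʳ : ∀ n → n · 0ℚ ≡ 0ℚ
·-zeroʳ zero    = refl
·-zeroʳ (suc n) = trans (ℚ.+-identityˡ _) (·-zeroʳ n)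

·-comm : ∀ m n p → m · (n · p) ≡ n · (m · p)
·-comm m n p = trans (×-assocˡ p m n) (trans (cong (_· p) (ℕ.*-comm m n)) (sym (×-assocˡ p n m)))

·-monoʳ-≤ : ∀ n {p q} → p ≤ℚ q → n · p ≤ℚ n · q
·-monoʳ-≤ zero    p≤q = ℚ.≤-refl
·-monoʳ-≤ (suc n) p≤q = ℚ.+-mono-≤ p≤q (·-monoʳ-≤ n p≤q)

·-nonNeg : ∀ n {p} → 0ℚ ≤ℚ p → 0ℚ ≤ℚ n · p
·-nonNeg n 0≤p = subst (_≤ℚ n · _) (·-zeroʳ n) (·-monoʳ-≤ n 0≤p)

·-monoˡ-≤ : ∀ {p m n} → 0ℚ ≤ℚ p → m ≤ n → m · p ≤ℚ n · p
·-monoˡ-≤     0≤p (z≤n {n}) = ·-nonNeg n 0≤p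
·-monoˡ-≤ {p} 0≤p (s≤s m≤n) = ℚ.+-monoʳ-≤ p (·-monoˡ-≤ 0≤p m≤n)

·-monoˡ-< : ∀ {p m n} → 0ℚ <ℚ p → m < n → m · p <ℚ n · p
·-monoˡ-< {p} 0<p (s≤s (z≤n {n})) =
  subst (_<ℚ p +ℚ n · p) (ℚ.+-identityʳ 0ℚ) (ℚ.+-mono-<-≤ 0<p (·-nonNeg n (ℚ.<⇒≤ 0<p)))
·-monoˡ-< {p} 0<p (s≤s (s≤s m<n)) = ℚ.+-monoʳ-< p (·-monoˡ-< 0<p (s≤s m<n))

·-cancelʳ-≤ : ∀ {p m n} → 0ℚ <ℚ p → m · p ≤ℚ n · p → m ≤ n
·-cancelʳ-≤ 0<p mp≤np = ℕ.≮⇒≥ λ n<m → ℚ.<-irrefl refl (ℚ.<-≤-trans (·-monoˡ-< 0<p n<m) mp≤np)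

·-rescale-≤ : ∀ k a b {P P′ Q} → a · Q ≤ℚ b · P′ → k · P′ ≤ℚ P → (k * a) · Q ≤ℚ b · P
·-rescale-≤ k a b {P} {P′} {Q} aQ≤bP′ kP′≤P = begin
  (k * a) · Q   ≡⟨ ×-assocˡ Q k a ⟨
  k · (a · Q)   ≤⟨ ·-monoʳ-≤ k aQ≤bP′ ⟩
  k · (b · P′)  ≡⟨ ·-comm k b P′ ⟩
  b · (k · P′)  ≤⟨ ·-monoʳ-≤ b kP′≤P ⟩
  b · P         ∎
  where open ℚ.≤-Reasoning

·-cross-cancel : ∀ a b c e {P Q} → 0ℚ <ℚ P → a · Q ≤ℚ b · P → c · P ≤ℚ e · Q → a * c ≤ b * e
·-cross-cancel a b c e {P} {Q} 0<P aQ≤bP cP≤eQ = ·-cancelʳ-≤ 0<P (begin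
  (a * c) · P   ≡⟨ ×-assocˡ P a c ⟨
  a · (c · P)   ≤⟨ ·-monoʳ-≤ a cP≤eQ ⟩
  a · (e · Q)   ≡⟨ ·-comm a e Q ⟩
  e · (a · Q)   ≤⟨ ·-monoʳ-≤ e aQ≤bP ⟩
  e · (b · P)   ≡⟨ ×-assocˡ P e b ⟩
  (e * b) · P   ≡⟨ cong (_· P) (ℕ.*-comm e b) ⟩
  (b * e) · P   ∎)
  where open ℚ.≤-Reasoning

+ℚ-cancelʳ-≤ : ∀ {x y} z → x +ℚ z ≤ℚ y +ℚ z → x ≤ℚ y
+ℚ-cancelʳ-≤ {x} {y} z x+z≤y+z = subst₂ _≤ℚ_ (cancel x) (cancel y) (ℚ.+-monoˡ-≤ (- z) x+z≤y+z)
  where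
    open import Data.Rational.Solver using (module +-*-Solver)
    open +-*-Solver
    cancel : ∀ a → a +ℚ z +ℚ - z ≡ a
    cancel a = solve 2 (λ a z → a :+ z :+ :- z := a) refl a z

module Σℚ = ScaledLayerSum (Ring.semiring ℚ.+-*-ring)

Σℚ-mono : ∀ (ρ : Subcube N) w {f g} → (∀ x → x ∈ᶜ ρ → weight x ≡ w → f x ≤ℚ g x) → Σℚ.Σ ρ w f ≤ℚ Σℚ.Σ ρ w g
Σℚ-mono = layerSum-preserves 0ℚ _+ℚ_ _≤ℚ_ ℚ.≤-refl ℚ.+-mono-≤

Σℚ-nonNeg : ∀ (ρ : Subcube N) w {g} → (∀ x → 0ℚ ≤ℚ g x) → 0ℚ ≤ℚ Σℚ.Σ ρ w g
Σℚ-nonNeg ρ w {g} 0≤g = subst (_≤ℚ Σℚ.Σ ρ w g) (Σℚ.Σ-ε ρ w) (Σℚ-mono ρ w λ x _ _ → 0≤g x)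

Σℚ-pos : ∀ {N w} → w ≤ N → ∀ {g : Input N → ℚ} → (∀ x → 0ℚ <ℚ g x) → 0ℚ <ℚ Σℚ.Σ (unrestricted N) w g
Σℚ-pos {zero}  z≤n       0<g = 0<g ⟨⟩
Σℚ-pos {suc N} z≤n       0<g = Σℚ-pos z≤n λ x → 0<g (false ◃ x)
Σℚ-pos {suc N} {suc w} (s≤s w≤N) {g} 0<g =
  subst (_<ℚ Σℚ.Σ (unrestricted (suc N)) (suc w) g) (ℚ.+-identityʳ 0ℚ)
        (ℚ.+-mono-≤-< (Σℚ-nonNeg (unrestricted N) (suc w) λ x → ℚ.<⇒≤ (0<g (false ◃ x)))
                      (Σℚ-pos w≤N λ x → 0<g (true ◃ x)))

mass : (Out → Bool) → Dist N → ℕ → ℚ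
mass     S []             w = 0ℚ
mass {N} S ((p , t) ∷ A) w = layerCount t S (unrestricted N) w · p +ℚ mass S A w

Σℚ-prob : ∀ S (A : Dist N) w → Σℚ.Σ (unrestricted N) w (prob S A) ≡ mass S A w
Σℚ-prob {N} S []             w = Σℚ.Σ-ε (unrestricted N) w
Σℚ-prob {N} S ((p , t) ∷ A) w =
  trans (Σℚ.Σ-∙ (unrestricted N) w (λ x → if S (eval t x) then p else 0ℚ) (prob S A))
        (cong₂ _+ℚ_ (trans (Σℚ.Σ-cong (unrestricted N) w λ x _ _ → if-as-· (S (eval t x)))
                           (Σℚ.Σ-· (unrestricted N) w (λ x → if S (eval t x) then 1 else 0) p))
                    (Σℚ-prob S A w))
  where
    if-as-· : ∀ b → (if b then p else 0ℚ) ≡ (if b then 1 else 0) · p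
    if-as-· true  = sym (ℚ.+-identityʳ p)
    if-as-· false = refl

isNotBot-split : ∀ b o p → (if isNotBot o then p else 0ℚ) ≡
                 (if isOut (not b) o then p else 0ℚ) +ℚ (if isOut b o then p else 0ℚ)
isNotBot-split b     nothing      p = sym (ℚ.+-identityʳ 0ℚ)
isNotBot-split false (just false) p = sym (ℚ.+-identityˡ p)
isNotBot-split false (just true)  p = sym (ℚ.+-identityʳ p)
isNotBot-split true  (just false) p = sym (ℚ.+-identityʳ p)
isNotBot-split true  (just true)  p = sym (ℚ.+-identityˡ p)

prob-isNotBot : ∀ b (A : Dist N) x → prob isNotBot A x ≡ prob (isOut (not b)) A x +ℚ prob (isOut b) A x
prob-isNotBot b []             x = sym (ℚ.+-identityʳ 0ℚ)
prob-isNotBot b ((p , t) ∷ A) x =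
  trans (cong₂ _+ℚ_ (isNotBot-split b (eval t x) p) (prob-isNotBot b A x))
        (interchange (if isOut (not b) (eval t x) then p else 0ℚ) (if isOut b (eval t x) then p else 0ℚ)
                     (prob (isOut (not b)) A x) (prob (isOut b) A x))
  where open import Algebra.Properties.CommutativeSemigroup
                      (CommutativeMonoid.commutativeSemigroup ℚ.+-0-commutativeMonoid) using (interchange)

Σℚ-prob-isNotBot : ∀ b (A : Dist N) w →
  Σℚ.Σ (unrestricted N) w (prob isNotBot A) ≡ mass (isOut (not b)) A w +ℚ mass (isOut b) A w
Σℚ-prob-isNotBot {N} b A w = begin
  Σ ρ w (prob isNotBot A)                                      ≡⟨ Σ-cong ρ w (λ x _ _ → prob-isNotBot b A x) ⟩
  Σ ρ w (λ x → prob (isOut (not b)) A x +ℚ prob (isOut b) A x)  ≡⟨ Σ-∙ ρ w _ _ ⟩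
  Σ ρ w (prob (isOut (not b)) A) +ℚ Σ ρ w (prob (isOut b) A)   ≡⟨ cong₂ _+ℚ_ (Σℚ-prob _ A w) (Σℚ-prob _ A w) ⟩
  mass (isOut (not b)) A w +ℚ mass (isOut b) A w               ∎
  where open ≡-Reasoning
        open Σℚ
        ρ = unrestricted N

module Postselection {ε : ℚ} {f : Input N → Bool} {A : Dist N} (post : PostAlg ε f A) where

  postselection-on-layer : ∀ w b → (∀ x → weight x ≡ w → f x ≡ b) →
    (1ℚ - ε) *ℚ (mass (isOut (not b)) A w +ℚ mass (isOut b) A w) ≤ℚ mass (isOut b) A w
  postselection-on-layer w b f≡b = begin
    (1ℚ - ε) *ℚ (mass (isOut (not b)) A w +ℚ mass (isOut b) A w)
      ≡⟨ cong ((1ℚ - ε) *ℚ_) (Σℚ-prob-isNotBot b A w) ⟨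
    (1ℚ - ε) *ℚ Σ ρ w (prob isNotBot A)                  ≡⟨ Σ-*ˡ ρ w (1ℚ - ε) (prob isNotBot A) ⟨
    Σ ρ w (λ x → (1ℚ - ε) *ℚ prob isNotBot A x)
      ≤⟨ Σℚ-mono ρ w (λ x _ |x|≡w → subst (λ c → _ ≤ℚ prob (isOut c) A x) (f≡b x |x|≡w) (proj₂ (proj₂ post x))) ⟩
    Σ ρ w (prob (isOut b) A)                              ≡⟨ Σℚ-prob (isOut b) A w ⟩
    mass (isOut b) A w                                    ∎
    where open ℚ.≤-Reasoning
          open Σℚ
          ρ = unrestricted N

  acceptance-pos : ∀ {w} b → w ≤ N → 0ℚ <ℚ mass (isOut (not b)) A w +ℚ mass (isOut b) A w
  acceptance-pos b w≤N = subst (0ℚ <ℚ_) (Σℚ-prob-isNotBot b A _) (Σℚ-pos w≤N λ x → proj₁ (proj₂ post x))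

mass-·-≤ : ∀ S (A : Dist N) {d} a b {v v′} → All (λ pt → 0ℚ <ℚ proj₁ pt) A → distDepth A ≤ d →
  (∀ (t : DT N) → depth t ≤ d → a * layerCount t S (unrestricted N) v ≤ b * layerCount t S (unrestricted N) v′) →
  a · mass S A v ≤ℚ b · mass S A v′
mass-·-≤ S [] a b _ _ _ = ℚ.≤-reflexive (trans (·-zeroʳ a) (sym (·-zeroʳ b)))
mass-·-≤ {N} S ((p , t) ∷ A) a b {v} {v′} (0<p ∷ 0<A) depth≤d bound = begin
  a · (count v · p +ℚ mass S A v)       ≡⟨ ×-distrib-+ (count v · p) (mass S A v) a ⟩
  a · (count v · p) +ℚ a · mass S A v   ≡⟨ cong (_+ℚ a · mass S A v) (×-assocˡ p a (count v)) ⟩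
  (a * count v) · p +ℚ a · mass S A v
    ≤⟨ ℚ.+-mono-≤ (·-monoˡ-≤ (ℚ.<⇒≤ 0<p) (bound t (ℕ.m⊔n≤o⇒m≤o _ _ depth≤d)))
                  (mass-·-≤ S A a b 0<A (ℕ.m⊔n≤o⇒n≤o _ _ depth≤d) bound) ⟩
  (b * count v′) · p +ℚ b · mass S A v′ ≡⟨ cong (_+ℚ b · mass S A v′) (×-assocˡ p b (count v′)) ⟨
  b · (count v′ · p) +ℚ b · mass S A v′ ≡⟨ ×-distrib-+ (count v′ · p) (mass S A v′) b ⟨
  b · (count v′ · p +ℚ mass S A v′)     ∎
  where open ℚ.≤-Reasoning
        count = layerCount t S (unrestricted N)

-- Majority

m<2*[m∸n] : ∀ m n → 2 * n < m → m < 2 * (m ∸ n)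
m<2*[m∸n] m n 2n<m = subst (m <_) (sym (ℕ.*-distribˡ-∸ 2 m n)) (ℕ.m+n≤o⇒m≤o∸n (suc m)
  (subst (suc m + 2 * n ≤_) (cong (m +_) (sym (ℕ.+-identityʳ m))) (ℕ.+-monoʳ-< m 2n<m)))

2*⌊n/2⌋≤n : ∀ n → 2 * ⌊ n /2⌋ ≤ n
2*⌊n/2⌋≤n zero          = z≤n
2*⌊n/2⌋≤n (suc zero)    = z≤n
2*⌊n/2⌋≤n (suc (suc n)) = subst (_≤ suc (suc n)) (sym (ℕ.*-suc 2 ⌊ n /2⌋)) (s≤s (s≤s (2*⌊n/2⌋≤n n)))

n<2*[1+⌊n/2⌋] : ∀ n → n < 2 * suc ⌊ n /2⌋
n<2*[1+⌊n/2⌋] zero          = s≤s z≤n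
n<2*[1+⌊n/2⌋] (suc zero)    = s≤s (s≤s z≤n)
n<2*[1+⌊n/2⌋] (suc (suc n)) =
  subst (suc (suc n) <_) (sym (ℕ.*-suc 2 (suc ⌊ n /2⌋))) (s≤s (s≤s (n<2*[1+⌊n/2⌋] n)))

n≤2*[n∸⌊n/2⌋] : ∀ n → n ≤ 2 * (n ∸ ⌊ n /2⌋)
n≤2*[n∸⌊n/2⌋] n = begin
  n                               ≡⟨ ℕ.m+[n∸m]≡n (ℕ.⌊n/2⌋≤n n) ⟨
  ⌊ n /2⌋ + (n ∸ ⌊ n /2⌋)         ≤⟨ ℕ.+-monoˡ-≤ (n ∸ ⌊ n /2⌋) (ℕ.m+n≤o⇒m≤o∸n ⌊ n /2⌋ 2⌊n/2⌋≤n) ⟩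
  (n ∸ ⌊ n /2⌋) + (n ∸ ⌊ n /2⌋)   ≡⟨ cong ((n ∸ ⌊ n /2⌋) +_) (ℕ.+-identityʳ (n ∸ ⌊ n /2⌋)) ⟨
  2 * (n ∸ ⌊ n /2⌋)               ∎
  where open ℕ.≤-Reasoning
        2⌊n/2⌋≤n = subst (_≤ n) (cong (⌊ n /2⌋ +_) (ℕ.+-identityʳ ⌊ n /2⌋)) (2*⌊n/2⌋≤n n)

middle-layer-degrees : ∀ {N d} → 4 * d < N →
  let ρ = unrestricted N ; w = ⌊ N /2⌋ in
  downDegree ρ w * upDegree ρ w < (2 * (downDegree ρ w ∸ d)) * (2 * (upDegree ρ w ∸ d))
middle-layer-degrees {N} {d} 4d<N rewrite fixed-unrestricted true N | fixed-unrestricted false N =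
  ℕ.*-mono-< (m<2*[m∸n] _ d (ℕ.*-cancelˡ-< 2 _ _ (ℕ.<-trans 2[2d]<N (n<2*[1+⌊n/2⌋] N))))
             (m<2*[m∸n] _ d (ℕ.*-cancelˡ-< 2 _ _ (ℕ.<-≤-trans 2[2d]<N (n≤2*[n∸⌊n/2⌋] N))))
  where 2[2d]<N = subst (_< N) (ℕ.*-assoc 2 2 d) 4d<N

MAJ-below : ∀ N x → 2 * weight x ≤ N → MAJ N x ≡ false
MAJ-below N x 2|x|≤N with N <? 2 * weight x
... | yes N<2|x| = ⊥-elim (ℕ.<⇒≱ N<2|x| 2|x|≤N)
... | no _       = refl

MAJ-above : ∀ N x → N < 2 * weight x → MAJ N x ≡ true
MAJ-above N x N<2|x| with N <? 2 * weight x
... | yes _     = refl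
... | no N≮2|x| = ⊥-elim (N≮2|x| N<2|x|)

countingTree : ∀ k → (Fin k → Fin N) → (ℕ → Out) → DT N
countingTree zero    f g = leaf (g 0)
countingTree (suc k) f g = node (f zero) (countingTree k (f ∘ suc) g) (countingTree k (f ∘ suc) (g ∘ suc))

eval-countingTree : ∀ k (f : Fin k → Fin N) g x → eval (countingTree k f g) x ≡ g (weight (x ∘ f))
eval-countingTree zero    f g x = refl
eval-countingTree (suc k) f g x with x (f zero)
... | false = eval-countingTree k (f ∘ suc) g x
... | true  = eval-countingTree k (f ∘ suc) (g ∘ suc) x

depth-countingTree : ∀ k (f : Fin k → Fin N) g → depth (countingTree k f g) ≤ k
depth-countingTree zero    f g = z≤n
depth-countingTree (suc k) f g =
  s≤s (ℕ.⊔-lub (depth-countingTree k (f ∘ suc) g) (depth-countingTree k (f ∘ suc) (g ∘ suc)))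

isOut-just : ∀ b → isOut b (just b) ≡ true
isOut-just false = refl
isOut-just true  = refl

postR-exact : ∀ {ε d} {f : Input N → Bool} (t : DT N) → 0ℚ ≤ℚ ε →
              (∀ x → eval t x ≡ just (f x)) → depth t ≤ d → PostR≤ ε f d
postR-exact {ε = ε} {f = f} t 0≤ε t≡f depth≤d =
  A , ((ℚ.positive⁻¹ 1ℚ ∷ [] , ℚ.+-identityʳ 1ℚ) , correct) , subst (_≤ _) (sym (ℕ.⊔-identityʳ (depth t))) depth≤d
  where
    A = (1ℚ , t) ∷ []
    correct : ∀ x → (0ℚ <ℚ prob isNotBot A x) × ((1ℚ - ε) *ℚ prob isNotBot A x ≤ℚ prob (isOut (f x)) A x)
    correct x rewrite t≡f x | isOut-just (f x) | ℚ.+-identityʳ 1ℚ | ℚ.*-identityʳ (1ℚ - ε) =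
      ℚ.positive⁻¹ 1ℚ , ℚ.+-monoʳ-≤ 1ℚ (ℚ.neg-antimono-≤ 0≤ε)

majorityOfWeight : ℕ → ℕ → Out
majorityOfWeight N k with N <? 2 * k
... | yes _ = just true
... | no _  = just false

majorityOfWeight-MAJ : ∀ N x → majorityOfWeight N (weight x) ≡ just (MAJ N x)
majorityOfWeight-MAJ N x with N <? 2 * weight x
... | yes _ = refl
... | no _  = refl

-- Imported this late because the integer `+_` makes the sections `m +_` on ℕ ambiguous.
open import Data.Integer using (+_)

module _ {X Y : ℚ} (postselected : (1ℚ - (+ 1) / 3) *ℚ (X +ℚ Y) ≤ℚ Y) where

  postselected-twice : 2 · X ≤ℚ Y
  postselected-twice = +ℚ-cancelʳ-≤ (2 · Y) (begin
    2 · X +ℚ 2 · Y                       ≡⟨ ×-distrib-+ X Y 2 ⟨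
    2 · (X +ℚ Y)                         ≡⟨ thrice-two-thirds (X +ℚ Y) ⟨
    3 · ((1ℚ - (+ 1) / 3) *ℚ (X +ℚ Y))   ≤⟨ ·-monoʳ-≤ 3 postselected ⟩
    Y +ℚ 2 · Y                           ∎)
    where
      open ℚ.≤-Reasoning
      open import Data.Rational.Solver using (module +-*-Solver)
      open +-*-Solver
      thrice-two-thirds : ∀ a → 3 · ((1ℚ - (+ 1) / 3) *ℚ a) ≡ 2 · a
      thrice-two-thirds = solve 1 (λ a → let c = con (1ℚ - (+ 1) / 3) :* a in
                                         c :+ (c :+ (c :+ con 0ℚ)) := a :+ (a :+ con 0ℚ)) refl

  postselected-pos : 0ℚ <ℚ X +ℚ Y → 0ℚ <ℚ Y
  postselected-pos 0<X+Y = ℚ.<-≤-trans (ℚ.*-monoʳ-<-pos (1ℚ - (+ 1) / 3) 0<X+Y) postselected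

postR-MAJ-lower : ∀ {N d} → PostR≤ ((+ 1) / 3) (MAJ N) d → N ≤ 4 * d
postR-MAJ-lower {N} {d} (A , post , depth≤d) = ℕ.≮⇒≥ λ 4d<N →
  ℕ.<⇒≱ (subst (_< (2 * (u ∸ d)) * (2 * (v ∸ d))) (ℕ.*-comm u v) (middle-layer-degrees {N} {d} 4d<N))
        separation
  where
    open Postselection {ε = (+ 1) / 3} {f = MAJ N} post
    ρ = unrestricted N
    w = ⌊ N /2⌋
    u = downDegree ρ w
    v = upDegree ρ w
    T₀ = mass (isOut true) A w
    F₀ = mass (isOut false) A w
    T₁ = mass (isOut true) A (suc w)
    F₁ = mass (isOut false) A (suc w)
    rejects-middle : (1ℚ - (+ 1) / 3) *ℚ (T₀ +ℚ F₀) ≤ℚ F₀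
    rejects-middle = postselection-on-layer w false λ x |x|≡w →
      MAJ-below N x (subst (λ k → 2 * k ≤ N) (sym |x|≡w) (2*⌊n/2⌋≤n N))
    accepts-above : (1ℚ - (+ 1) / 3) *ℚ (F₁ +ℚ T₁) ≤ℚ T₁
    accepts-above = postselection-on-layer (suc w) true λ x |x|≡1+w →
      MAJ-above N x (subst (λ k → N < 2 * k) (sym |x|≡1+w) (n<2*[1+⌊n/2⌋] N))
    separation : (2 * (u ∸ d)) * (2 * (v ∸ d)) ≤ v * u
    separation = ·-cross-cancel (2 * (u ∸ d)) v (2 * (v ∸ d)) u
      (postselected-pos {T₀} {F₀} rejects-middle (acceptance-pos false (ℕ.⌊n/2⌋≤n N)))
      (·-rescale-≤ 2 (u ∸ d) v
        (mass-·-≤ (isOut true) A (u ∸ d) v (proj₁ (proj₁ post)) depth≤d λ t depth-t≤d →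
          layerCount-ascent (isOut true) t depth-t≤d ρ w)
        (postselected-twice {T₀} {F₀} rejects-middle))
      (·-rescale-≤ 2 (v ∸ d) u
        (mass-·-≤ (isOut false) A (v ∸ d) u (proj₁ (proj₁ post)) depth≤d λ t depth-t≤d →
          layerCount-descent (isOut false) t depth-t≤d ρ w)
        (postselected-twice {F₁} {T₁} accepts-above))

postR-MAJ-upper : ∀ N → PostR≤ ((+ 1) / 3) (MAJ N) N
postR-MAJ-upper N =
  postR-exact (countingTree N id (majorityOfWeight N)) (ℚ.nonNegative⁻¹ ((+ 1) / 3))
    (λ x → trans (eval-countingTree N id (majorityOfWeight N) x) (majorityOfWeight-MAJ N x))
    (depth-countingTree N id _)

theorem3 : ∃[ c ] ∃[ K ] ∃[ N₀ ] (∀ (N : ℕ) → N₀ ≤ N →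
    PostR≤ ((+ 1) / 3) (MAJ N) (c * N)
    × (∀ (d : ℕ) → PostR≤ ((+ 1) / 3) (MAJ N) d → N ≤ K * d))
theorem3 = 1 , 4 , 0 , λ N _ →
  subst (PostR≤ ((+ 1) / 3) (MAJ N)) (sym (ℕ.*-identityˡ N)) (postR-MAJ-upper N) , λ d → postR-MAJ-lower
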